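{- Let $k\ge1$ and let $\bar{x},\bar{y}\in\{0,1\}^*$ be sorted (non-increasing) sequences such that $k\le s=|\bar{x}|+|\bar{y}|$, $|\bar{y}|\le\lfloor k/2\rfloor$, $|\bar{x}|\le\lfloor k/2\rfloor+2$ and $|\bar{y}|_1\le|\bar{x}|_1\le|\bar{y}|_1+4$. Let $x(i)$ denote $0$ if $i>|\bar x|$ and $x_i$ otherwise, and $y(i)$ denote $1$ if $i<1$, $0$ if $i>|\bar y|$, and $y_i$ otherwise. For $1\le j\le s$ let $i=\lceil j/2\rceil$ and $a_j=\max(\max(x(i+2),y(i)),\min(x(i+1),y(i-1)))$ if $j$ is even, and $a_j=\min(\max(x(i+1),y(i-1)),\min(x(i),y(i-2)))$ if $j$ is odd. Then $a_j\ge a_{j+1}$ for all $1\le j<s$, and $\bar a=\langle a_1,\dots,a_s\rangle$ is a permutation of $\bar x::\bar y$.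
   Context: $|\bar z|$ is the length and $|\bar z|_1$ the number of ones of a binary sequence $\bar z$; $::$ is concatenation. -}

module Defs where

open import Data.Bool using (Bool; true; false; _∧_; _∨_; if_then_else_)
import Data.Bool as B
open import Data.Nat using (ℕ; zero; suc; _+_; _/_)
import Data.Nat as N
open import Data.Integer using (ℤ; +_; -[1+_])
open import Data.List using (List; []; _∷_; length)
open import Data.List.Relation.Unary.Linked using (Linked)

-- binary sequences are lists of Bool (false = 0, true = 1);
-- max on {0,1} is _∨_, min is _∧_, the order is Data.Bool._≤_ (false ≤ true)

SortedDesc : List Bool → Set
SortedDesc = Linked (λ a b → b B.≤ a)

ones : List Bool → ℕ
ones [] = 0
ones (true ∷ zs) = suc (ones zs)
ones (false ∷ zs) = ones zs

-- 1-based lookup, value 0 (false) beyond the end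
nth1 : List Bool → ℕ → Bool
nth1 [] _ = false
nth1 (z ∷ zs) zero = false   -- index 0 is never a valid 1-based index
nth1 (z ∷ zs) (suc zero) = z
nth1 (z ∷ zs) (suc (suc n)) = nth1 zs (suc n)

-- x(i): 0 if i > |x|, x_i otherwise (i < 1 never occurs; set to 0)
xAt : List Bool → ℤ → Bool
xAt xs (+ n) = nth1 xs n
xAt xs -[1+ n ] = false

yAt : List Bool → ℤ → Bool
yAt ys (+ zero) = true
yAt ys (+ suc n) = nth1 ys (suc n)
yAt ys -[1+ n ] = true

-- a_j for 1 ≤ j, with i = ⌈j/2⌉ = (j+1)/2
aj : List Bool → List Bool → ℕ → Bool
aj xs ys j with j N.% 2
... | zero =
  (xAt xs (i Data.Integer.+ + 2) ∨ yAt ys i) ∨ (xAt xs (i Data.Integer.+ + 1) ∧ yAt ys (i Data.Integer.- + 1))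
  where i = + ((j + 1) / 2)
... | suc _ =
  (xAt xs (i Data.Integer.+ + 1) ∨ yAt ys (i Data.Integer.- + 1)) ∧ (xAt xs i ∧ yAt ys (i Data.Integer.- + 2))
  where i = + ((j + 1) / 2)

abar : List Bool → List Bool → ℕ → List Bool
abar xs ys s = Data.List.applyUpTo (λ j → aj xs ys (suc j)) s

-- A sorted binary sequence is determined by its number of ones: with p = |x̄|₁ and
-- q = |ȳ|₁ we have x(i) = [i ≤ p] for i ≥ 1 and y(i) = [i ≤ q] for all i (the
-- convention y(i) = 1 for i < 1 fits this). Substituted into the formulas, a_j
-- becomes a Boolean combination of thresholds that, when q ≤ p ≤ q + 4, equals
-- [j ≤ p + q]: raising p, q and i by one does not change it, so only i = 1 and
-- q = 0 need checking, and for q = 0 the bound p ≤ 4 leaves a finite table.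
-- Hence ā = 1^(p+q) 0^(s-p-q), which is sorted and a permutation of x̄ :: ȳ.

module Submission where

open import Defs
open import Data.Bool using (Bool; true; false; _∧_; _∨_)
import Data.Bool as B
open import Data.Bool.Properties using (∨-zeroʳ; ≤-maximum)
open import Data.Nat using (ℕ; zero; suc; _+_; _*_; _≤_; _<_; _/_; _<ᵇ_; z≤n; s≤s)
open import Data.Nat.Properties using (+-suc; +-comm; +-identityʳ; ≤-trans; n≤1+n)
open import Data.Nat.DivMod using ([m+kn]%n≡m%n; m*n%n≡0; m*n/n≡m; +-distrib-/-∣ˡ)
open import Data.Nat.Divisibility using (divides)
open import Data.Integer using (+_; _⊖_)
import Data.Integer as ℤ
open import Data.Integer.Properties using ([1+m]⊖[1+n]≡m⊖n)
open import Data.List using (List; []; _∷_; length; _++_; applyUpTo; _∷ʳ_)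
open import Data.List.Properties using (length-++; applyUpTo-∷ʳ)
open import Data.List.Relation.Unary.Linked using ([-]; _∷_; tail)
open import Data.List.Relation.Binary.Permutation.Propositional
  using (_↭_; prep; ↭-refl; ↭-trans; ↭-reflexive; module PermutationReasoning)
open import Data.List.Relation.Binary.Permutation.Propositional.Properties using (∷↭∷ʳ)
open import Data.Product using (_×_; _,_)
open import Relation.Binary.PropositionalEquality
  using (_≡_; refl; sym; trans; cong; cong₂; subst₂; module ≡-Reasoning)

m≤n⇒n<ᵇm≡false : ∀ {m n} → m ≤ n → (n <ᵇ m) ≡ false
m≤n⇒n<ᵇm≡false z≤n = refl
m≤n⇒n<ᵇm≡false (s≤s m≤n) = m≤n⇒n<ᵇm≡false m≤n

suc-<ᵇ≤<ᵇ : ∀ m n → (suc m <ᵇ n) B.≤ (m <ᵇ n)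
suc-<ᵇ≤<ᵇ m zero = B.b≤b
suc-<ᵇ≤<ᵇ zero (suc n) = ≤-maximum (0 <ᵇ n)
suc-<ᵇ≤<ᵇ (suc m) (suc n) = suc-<ᵇ≤<ᵇ m n

data Halves : ℕ → Set where
  twice   : ∀ t → Halves (t * 2)
  twice+1 : ∀ t → Halves (suc (t * 2))

halves : ∀ n → Halves n
halves zero = twice 0
halves (suc n) with halves n
... | twice t   = twice+1 t
... | twice+1 t = twice (suc t)

[1+n*2]+1/2≡1+n : ∀ n → (suc (n * 2) + 1) / 2 ≡ suc n
[1+n*2]+1/2≡1+n n = trans (cong (λ m → suc m / 2) (+-comm (n * 2) 1)) (m*n/n≡m (suc n) 2)

[1+n]*2+1/2≡1+n : ∀ n → (suc n * 2 + 1) / 2 ≡ suc n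
[1+n]*2+1/2≡1+n n = begin
  (suc n * 2 + 1) / 2     ≡⟨ +-distrib-/-∣ˡ 1 {2} (divides (suc n) refl) ⟩
  suc n * 2 / 2 + 1 / 2   ≡⟨ cong (_+ 0) (m*n/n≡m (suc n) 2) ⟩
  suc n + 0               ≡⟨ +-identityʳ (suc n) ⟩
  suc n                   ∎
  where open ≡-Reasoning

applyUpTo-cong : ∀ {A : Set} {f g : ℕ → A} → (∀ j → f j ≡ g j) →
                 ∀ n → applyUpTo f n ≡ applyUpTo g n
applyUpTo-cong f≗g zero = refl
applyUpTo-cong f≗g (suc n) = cong₂ _∷_ (f≗g 0) (applyUpTo-cong (λ j → f≗g (suc j)) n)

ones-++ : ∀ xs ys → ones (xs ++ ys) ≡ ones xs + ones ys
ones-++ [] ys = refl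
ones-++ (true ∷ xs) ys = cong suc (ones-++ xs ys)
ones-++ (false ∷ xs) ys = ones-++ xs ys

ones≤length : ∀ zs → ones zs ≤ length zs
ones≤length [] = z≤n
ones≤length (true ∷ zs) = s≤s (ones≤length zs)
ones≤length (false ∷ zs) = ≤-trans (ones≤length zs) (n≤1+n _)

applyUpTo-<ᵇ-ones-↭ : ∀ zs → applyUpTo (_<ᵇ ones zs) (length zs) ↭ zs
applyUpTo-<ᵇ-ones-↭ [] = ↭-refl
applyUpTo-<ᵇ-ones-↭ (true ∷ zs) = prep true (applyUpTo-<ᵇ-ones-↭ zs)
applyUpTo-<ᵇ-ones-↭ (false ∷ zs) = begin
  applyUpTo f (suc n)        ≡⟨ applyUpTo-∷ʳ f n ⟨
  applyUpTo f n ∷ʳ (n <ᵇ o)  ≡⟨ cong (applyUpTo f n ∷ʳ_) (m≤n⇒n<ᵇm≡false (ones≤length zs)) ⟩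
  applyUpTo f n ∷ʳ false     ↭⟨ ∷↭∷ʳ false (applyUpTo f n) ⟨
  false ∷ applyUpTo f n      <⟨ applyUpTo-<ᵇ-ones-↭ zs ⟩
  false ∷ zs                 ∎
  where
  open PermutationReasoning
  o = ones zs
  n = length zs
  f = _<ᵇ o

falseHead⇒ones≡0 : ∀ {zs} → SortedDesc (false ∷ zs) → ones zs ≡ 0
falseHead⇒ones≡0 [-] = refl
falseHead⇒ones≡0 (B.b≤b ∷ zs↓) = falseHead⇒ones≡0 zs↓

falseHead⇒nth1≡false : ∀ {zs} → SortedDesc (false ∷ zs) → ∀ n → nth1 (false ∷ zs) n ≡ false
falseHead⇒nth1≡false _ zero = refl
falseHead⇒nth1≡false _ (suc zero) = refl
falseHead⇒nth1≡false [-] (suc (suc n)) = refl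
falseHead⇒nth1≡false (B.b≤b ∷ zs↓) (suc (suc n)) = falseHead⇒nth1≡false zs↓ (suc n)

nth1-sorted : ∀ {zs} → SortedDesc zs → ∀ n → nth1 zs (suc n) ≡ (n <ᵇ ones zs)
nth1-sorted {[]} _ n = refl
nth1-sorted {true ∷ zs} _ zero = refl
nth1-sorted {true ∷ zs} zs↓ (suc n) = nth1-sorted (tail zs↓) n
nth1-sorted {false ∷ zs} zs↓ n rewrite falseHead⇒ones≡0 zs↓ = falseHead⇒nth1≡false zs↓ (suc n)

xAt-sorted : ∀ {xs} → SortedDesc xs → ∀ n k → xAt xs (+ suc n ℤ.+ + k) ≡ (k + n <ᵇ ones xs)
xAt-sorted {xs} xs↓ n k = trans (cong (λ m → nth1 xs (suc m)) (+-comm n k)) (nth1-sorted xs↓ (k + n))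

yAt-sorted : ∀ {ys} → SortedDesc ys → ∀ n k → yAt ys (n ⊖ k) ≡ (n <ᵇ suc (k + ones ys))
yAt-sorted ys↓ zero zero = refl
yAt-sorted ys↓ (suc n) zero = nth1-sorted ys↓ n
yAt-sorted ys↓ zero (suc k) = refl
yAt-sorted {ys} ys↓ (suc n) (suc k) = trans (cong (yAt ys) ([1+m]⊖[1+n]≡m⊖n n k)) (yAt-sorted ys↓ n k)

-- a_(2t+1) and a_(2t+2) of the paper (so i = t + 1), with x(i) = [i ≤ p] and
-- y(i) = [i ≤ q] written as t-thresholds.
oddEntry : ℕ → ℕ → ℕ → Bool
oddEntry p q t = ((suc t <ᵇ p) ∨ (t <ᵇ suc q)) ∧ ((t <ᵇ p) ∧ (t <ᵇ 2 + q))

evenEntry : ℕ → ℕ → ℕ → Bool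
evenEntry p q t = ((2 + t <ᵇ p) ∨ (suc t <ᵇ suc q)) ∨ ((suc t <ᵇ p) ∧ (t <ᵇ suc q))

oddEntry-noOnesInY : ∀ p t → p ≤ 4 → oddEntry p 0 t ≡ (t * 2 <ᵇ p)
oddEntry-noOnesInY 0 0 _ = refl
oddEntry-noOnesInY 0 (suc t) _ = refl
oddEntry-noOnesInY 1 0 _ = refl
oddEntry-noOnesInY 1 (suc t) _ = refl
oddEntry-noOnesInY 2 0 _ = refl
oddEntry-noOnesInY 2 (suc t) _ = refl
oddEntry-noOnesInY 3 0 _ = refl
oddEntry-noOnesInY 3 1 _ = refl
oddEntry-noOnesInY 3 (suc (suc t)) _ = refl
oddEntry-noOnesInY 4 0 _ = refl
oddEntry-noOnesInY 4 1 _ = refl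
oddEntry-noOnesInY 4 2 _ = refl
oddEntry-noOnesInY 4 (suc (suc (suc t))) _ = refl
oddEntry-noOnesInY (suc (suc (suc (suc (suc _))))) _ (s≤s (s≤s (s≤s (s≤s ()))))

evenEntry-noOnesInY : ∀ p t → p ≤ 4 → evenEntry p 0 t ≡ (suc (t * 2) <ᵇ p)
evenEntry-noOnesInY 0 t _ = refl
evenEntry-noOnesInY 1 t _ = refl
evenEntry-noOnesInY 2 0 _ = refl
evenEntry-noOnesInY 2 (suc t) _ = refl
evenEntry-noOnesInY 3 0 _ = refl
evenEntry-noOnesInY 3 1 _ = refl
evenEntry-noOnesInY 3 (suc (suc t)) _ = refl
evenEntry-noOnesInY 4 0 _ = refl
evenEntry-noOnesInY 4 1 _ = refl
evenEntry-noOnesInY 4 2 _ = refl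
evenEntry-noOnesInY 4 (suc (suc (suc t))) _ = refl
evenEntry-noOnesInY (suc (suc (suc (suc (suc _))))) _ (s≤s (s≤s (s≤s (s≤s ()))))

-- Both entries are invariant under (p, q, t) ↦ (p + 1, q + 1, t + 1), which is the
-- inductive step; the cases t = 0 and q = 0 are the base.
oddEntry-threshold : ∀ {p q} t → q ≤ p → p ≤ q + 4 → oddEntry p q t ≡ (t * 2 <ᵇ p + q)
oddEntry-threshold {p} {zero} t _ p≤4 =
  trans (oddEntry-noOnesInY p t p≤4) (cong (t * 2 <ᵇ_) (sym (+-identityʳ p)))
oddEntry-threshold {suc p} {suc q} zero _ _ = cong (_∧ true) (∨-zeroʳ (0 <ᵇ p))
oddEntry-threshold {suc p} {suc q} (suc t) (s≤s q≤p) (s≤s p≤q+4) =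
  trans (oddEntry-threshold t q≤p p≤q+4) (sym (cong (suc (t * 2) <ᵇ_) (+-suc p q)))

evenEntry-threshold : ∀ {p q} t → q ≤ p → p ≤ q + 4 → evenEntry p q t ≡ (suc (t * 2) <ᵇ p + q)
evenEntry-threshold {p} {zero} t _ p≤4 =
  trans (evenEntry-noOnesInY p t p≤4) (cong (suc (t * 2) <ᵇ_) (sym (+-identityʳ p)))
evenEntry-threshold {suc p} {suc q} zero _ _ rewrite ∨-zeroʳ (1 <ᵇ p) | +-suc p q = refl
evenEntry-threshold {suc p} {suc q} (suc t) (s≤s q≤p) (s≤s p≤q+4) =
  trans (evenEntry-threshold t q≤p p≤q+4) (sym (cong (2 + t * 2 <ᵇ_) (+-suc p q)))

module _ {xs ys : List Bool} (xs↓ : SortedDesc xs) (ys↓ : SortedDesc ys) where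

  aj-odd : ∀ t → aj xs ys (suc (t * 2)) ≡ oddEntry (ones xs) (ones ys) t
  aj-odd t rewrite [m+kn]%n≡m%n 1 t 2 ⦃ _ ⦄ | [1+n*2]+1/2≡1+n t =
    cong₂ _∧_ (cong₂ _∨_ (xAt-sorted xs↓ t 1) (yAt-sorted ys↓ (suc t) 1))
              (cong₂ _∧_ (nth1-sorted xs↓ t) (yAt-sorted ys↓ (suc t) 2))

  aj-even : ∀ t → aj xs ys (suc t * 2) ≡ evenEntry (ones xs) (ones ys) t
  aj-even t rewrite m*n%n≡0 (suc t) 2 ⦃ _ ⦄ | [1+n]*2+1/2≡1+n t =
    cong₂ _∨_ (cong₂ _∨_ (xAt-sorted xs↓ t 2) (yAt-sorted ys↓ (suc t) 0))
              (cong₂ _∧_ (xAt-sorted xs↓ t 1) (yAt-sorted ys↓ (suc t) 1))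

  aj-threshold : ones ys ≤ ones xs → ones xs ≤ ones ys + 4 →
                 ∀ j → aj xs ys (suc j) ≡ (j <ᵇ ones xs + ones ys)
  aj-threshold q≤p p≤q+4 j with halves j
  ... | twice t   = trans (aj-odd t) (oddEntry-threshold t q≤p p≤q+4)
  ... | twice+1 t = trans (aj-even t) (evenEntry-threshold t q≤p p≤q+4)

mainTheorem16 : (k : ℕ) → (xs ys : List Bool) →
    1 ≤ k → SortedDesc xs → SortedDesc ys →
    k ≤ length xs + length ys →
    length ys ≤ k / 2 → length xs ≤ k / 2 + 2 →
    ones ys ≤ ones xs → ones xs ≤ ones ys + 4 →
    ((j : ℕ) → 1 ≤ j → j < length xs + length ys →
      aj xs ys (suc j) B.≤ aj xs ys j)
    × (abar xs ys (length xs + length ys) ↭ xs ++ ys)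
mainTheorem16 _ xs ys _ xs↓ ys↓ _ _ _ q≤p p≤q+4 = descending , permutation
  where
  a≡ : ∀ j → aj xs ys (suc j) ≡ (j <ᵇ ones xs + ones ys)
  a≡ = aj-threshold xs↓ ys↓ q≤p p≤q+4

  descending : (j : ℕ) → 1 ≤ j → j < length xs + length ys → aj xs ys (suc j) B.≤ aj xs ys j
  descending (suc j) _ _ =
    subst₂ B._≤_ (sym (a≡ (suc j))) (sym (a≡ j)) (suc-<ᵇ≤<ᵇ j (ones xs + ones ys))

  permutation : abar xs ys (length xs + length ys) ↭ xs ++ ys
  permutation = ↭-trans (↭-reflexive (applyUpTo-cong a≡ _))
    (subst₂ (λ o n → applyUpTo (_<ᵇ o) n ↭ xs ++ ys) (ones-++ xs ys) (length-++ xs)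
            (applyUpTo-<ᵇ-ones-↭ (xs ++ ys)))
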